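{- Let $R,S\in\mathfrak{U}$ and $\mathfrak{U}'\subseteq\mathfrak{U}$, let $\mathcal{E}(R),\mathcal{E}(S)$ be the EV-systems of $R,S$ with respect to $\mathfrak{U}'$, and let $\epsilon:\mathcal{E}(R)\to\mathcal{E}(S)$ be a strict homomorphism. Let $\mathfrak{a}\in\mathcal{E}_o(R)$ satisfy: - $\#\epsilon(\mathfrak{a})_2\le\#\mathfrak{a}_2$; - for all $\mathfrak{b},\mathfrak{c}\in N_{\mathcal{E}(R)}(\mathfrak{a})$, $\epsilon(\mathfrak{b})_1=\epsilon(\mathfrak{c})_1$ implies $\mathfrak{b}_1=\mathfrak{c}_1$. Then $\alpha^S_{G,\eta_G(\xi)}(v)=\epsilon(\alpha^R_{G,\xi}(v))$ for all $G\in\mathfrak{U}'$, $\xi\in\mathcal{S}_u(G,R)$ and $v\in V(G)$ with $\alpha^R_{G,\xi}(v)=\mathfrak{a}$. In particular, if these conditions hold for all $\mathfrak{a}\in\mathcal{E}_o(R)$, then $\alpha^S_{G,\eta_G(\xi)}=\epsilon\circ\alpha^R_{G,\xi}$ for all $G\in\mathfrak{U}'$ and $\xi\in\mathcal{S}_u(G,R)$ (Condition 1).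
   Context: An undirected graph $G$ has a finite nonempty vertex set and an edge set $A(G)$ of 1-element subsets (loops) and 2-element subsets (proper edges) of $V(G)$. $N_G(v)=\{w\ne v:\{v,w\}\in A(G)\}$. A homomorphism maps edges to edges; it is strict if, in addition, it maps proper edges to proper edges. $\mathcal{S}_u(G,H)$ is the set of strict homomorphisms. $\mathfrak{U}$ is a representative system of the isomorphism classes of finite undirected graphs. EV-system of $T\in\{R,S\}$ with respect to $\mathfrak{U}'$: - Vertex set $\mathcal{E}_o(T)=\{(v,D):v\in V(T),\ D\subseteq N_T(v)\}$, with components $\mathfrak{a}_1,\mathfrak{a}_2$. - $\phi_T(\mathfrak{a})=\mathfrak{a}_1$. - $\alpha^T_{G,\xi}(v)=(\xi(v),\xi[N_G(v)])$ for $G\in\mathfrak{U}'$ and $\xi\in\mathcal{S}_u(G,T)$. - $\{\mathfrak{a},\mathfrak{b}\}$ ($\mathfrak{a}=\mathfrak{b}$ allowed) is an edge of $\mathcal{E}(T)$ iff there exist $G\in\mathfrak{U}'$, $\xi\in\mathcal{S}_u(G,T)$ and $\{v,w\}\in A(G)$ ($v=w$ allowed) with $\mathfrak{a}=\alpha^T_{G,\xi}(v)$ and $\mathfrak{b}=\alpha^T_{G,\xi}(w)$. $\eta_G(\xi):=\phi_S\circ\epsilon\circ\alpha^R_{G,\xi}$. -}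

module Defs where

open import Data.Nat using (ℕ; zero; suc; _≤_)
open import Data.Bool using (Bool; true; false; _∧_; _∨_; not)
open import Data.Fin using (Fin; zero; suc; _≟_)
open import Data.Fin.Subset using (Subset; _∈_; _⊆_; ∣_∣)
open import Data.Fin.Subset.Properties using (_⊆?_)
open import Data.Vec using (lookup; tabulate)
open import Data.Vec.Properties using (lookup⇒[]=; []=⇒lookup; lookup∘tabulate)
open import Data.Product using (Σ; ∃; _×_; _,_; proj₁; proj₂)
open import Relation.Nullary using (¬_; yes; no)
open import Relation.Nullary.Decidable using (True; ⌊_⌋; fromWitness)
open import Relation.Binary.PropositionalEquality
  using (_≡_; _≢_; refl; sym; trans; cong)

-- Finite undirected graphs with a nonempty vertex set Fin (suc k).
-- adj v w ≡ true  iff  {v,w} ∈ A(G)   (v ≡ w : a loop).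

record Graph : Set where
  field
    k   : ℕ
    adj : Fin (suc k) → Fin (suc k) → Bool
    adj-sym : ∀ v w → adj v w ≡ adj w v

open Graph public

V : Graph → Set
V G = Fin (suc (k G))

nbhd : (G : Graph) → V G → Subset (suc (k G))
nbhd G v = tabulate λ w → not ⌊ v ≟ w ⌋ ∧ adj G v w

IsStrictHom : (G H : Graph) → (V G → V H) → Set
IsStrictHom G H f =
  (∀ v w → adj G v w ≡ true → adj H (f v) (f w) ≡ true) ×
  (∀ v w → v ≢ w → adj G v w ≡ true → f v ≢ f w)

StrictHom : Graph → Graph → Set
StrictHom G H = Σ (V G → V H) (IsStrictHom G H)

anyᶠ : ∀ {n} → (Fin n → Bool) → Bool
anyᶠ {zero}  f = false
anyᶠ {suc n} f = f zero ∨ anyᶠ (λ x → f (suc x))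

image : ∀ {m n} → (Fin m → Fin n) → Subset m → Subset n
image f p = tabulate λ y → anyᶠ λ x → lookup p x ∧ ⌊ f x ≟ y ⌋

EVo : Graph → Set
EVo T = Σ (V T × Subset (suc (k T))) λ p → True (proj₂ p ⊆? nbhd T (proj₁ p))

comp₁ : (T : Graph) → EVo T → V T
comp₁ T a = proj₁ (proj₁ a)

comp₂ : (T : Graph) → EVo T → Subset (suc (k T))
comp₂ T a = proj₂ (proj₁ a)

φ : (T : Graph) → EVo T → V T
φ T = comp₁ T

αpair : (G T : Graph) → (V G → V T) → V G → V T × Subset (suc (k T))
αpair G T f v = f v , image f (nbhd G v)

private
  anyᶠ-witness : ∀ {n} (f : Fin n → Bool) → anyᶠ f ≡ true → ∃ λ x → f x ≡ true
  anyᶠ-witness {zero} f ()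
  anyᶠ-witness {suc n} f e with f zero in eq
  ... | true  = zero , eq
  ... | false with anyᶠ-witness (λ x → f (suc x)) e
  ...   | x , ex = suc x , ex

  ∧-proj₁ : ∀ a b → (a ∧ b) ≡ true → a ≡ true
  ∧-proj₁ true b e = refl

  ∧-proj₂ : ∀ a b → (a ∧ b) ≡ true → b ≡ true
  ∧-proj₂ true b e = e

  dec-true : ∀ {n} (x y : Fin n) → ⌊ x ≟ y ⌋ ≡ true → x ≡ y
  dec-true x y e with x ≟ y
  ... | yes p = p
  dec-true x y () | no _

  not-dec : ∀ {n} (x y : Fin n) → not ⌊ x ≟ y ⌋ ≡ true → x ≢ y
  not-dec x y e with x ≟ y
  not-dec x y () | yes _
  ... | no ¬p = ¬p

  not-dec′ : ∀ {n} (x y : Fin n) → x ≢ y → not ⌊ x ≟ y ⌋ ≡ true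
  not-dec′ x y ne with x ≟ y
  ... | yes p = Data.Empty.⊥-elim (ne p)
    where import Data.Empty
  ... | no _ = refl

  ∧-intro : ∀ {a b} → a ≡ true → b ≡ true → (a ∧ b) ≡ true
  ∧-intro refl refl = refl

α-valid : (G T : Graph) (ξ : StrictHom G T) (v : V G) →
          image (proj₁ ξ) (nbhd G v) ⊆ nbhd T (proj₁ ξ v)
α-valid G T (f , hom , strict) v {y} y∈ = lookup⇒[]= y _ goal
  where
  e₁ = trans (sym (lookup∘tabulate (λ y′ → anyᶠ λ x → lookup (nbhd G v) x ∧ ⌊ f x ≟ y′ ⌋) y)) ([]=⇒lookup y∈)
  w = anyᶠ-witness (λ x → lookup (nbhd G v) x ∧ ⌊ f x ≟ y ⌋) e₁
  x = proj₁ w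
  inN : lookup (nbhd G v) x ≡ true
  inN = ∧-proj₁ _ _ (proj₂ w)
  fx≡y : f x ≡ y
  fx≡y = dec-true _ _ (∧-proj₂ _ _ (proj₂ w))
  inN′ = trans (sym (lookup∘tabulate (λ w′ → not ⌊ v ≟ w′ ⌋ ∧ adj G v w′) x)) inN
  v≢x = not-dec v x (∧-proj₁ _ _ inN′)
  adjvx = ∧-proj₂ (not ⌊ v ≟ x ⌋) _ inN′
  goal : lookup (nbhd T (f v)) y ≡ true
  goal = trans (lookup∘tabulate (λ w′ → not ⌊ f v ≟ w′ ⌋ ∧ adj T (f v) w′) y)
    (∧-intro (not-dec′ (f v) y λ e → strict v x v≢x adjvx (trans e (sym fx≡y)))
             (trans (cong (adj T (f v)) (sym fx≡y)) (hom v x adjvx)))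

α : (G T : Graph) → StrictHom G T → V G → EVo T
α G T ξ v = αpair G T (proj₁ ξ) v , fromWitness (λ {y} → α-valid G T ξ v {y})

EVEdge : (𝔘′ : Graph → Set) (T : Graph) → EVo T → EVo T → Set
EVEdge 𝔘′ T 𝔞 𝔟 =
  Σ Graph λ G → 𝔘′ G × Σ (StrictHom G T) λ ξ → Σ (V G) λ v → Σ (V G) λ w →
    adj G v w ≡ true × α G T ξ v ≡ 𝔞 × α G T ξ w ≡ 𝔟

InEVNbhd : (𝔘′ : Graph → Set) (T : Graph) → EVo T → EVo T → Set
InEVNbhd 𝔘′ T 𝔞 𝔟 = 𝔟 ≢ 𝔞 × EVEdge 𝔘′ T 𝔞 𝔟

IsStrictEVHom : (𝔘′ : Graph → Set) (R S : Graph) → (EVo R → EVo S) → Set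
IsStrictEVHom 𝔘′ R S ε =
  (∀ 𝔞 𝔟 → EVEdge 𝔘′ R 𝔞 𝔟 → EVEdge 𝔘′ S (ε 𝔞) (ε 𝔟)) ×
  (∀ 𝔞 𝔟 → 𝔞 ≢ 𝔟 → EVEdge 𝔘′ R 𝔞 𝔟 → ε 𝔞 ≢ ε 𝔟)

η : (R S G : Graph) → (EVo R → EVo S) → StrictHom G R → V G → V S
η R S G ε ξ v = φ S (ε (α G R ξ v))

Hyp : (𝔘′ : Graph → Set) (R S : Graph) → (EVo R → EVo S) → EVo R → Set
Hyp 𝔘′ R S ε 𝔞 =
  (∣ comp₂ S (ε 𝔞) ∣ ≤ ∣ comp₂ R 𝔞 ∣) ×
  (∀ 𝔟 𝔠 → InEVNbhd 𝔘′ R 𝔞 𝔟 → InEVNbhd 𝔘′ R 𝔞 𝔠 →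
     comp₁ S (ε 𝔟) ≡ comp₁ S (ε 𝔠) → comp₁ R 𝔟 ≡ comp₁ R 𝔠)

module Submission where

-- Put 𝔞 = α(v) = (ξ v, ξ[N(v)]); the first components of both sides are η v by
-- definition, so only η[N(v)] = ε(𝔞)₂ is at stake. For w ∈ N(v), {𝔞, α(w)} is a proper
-- edge of E(R), and ε sends it to a proper edge of E(S); since a proper edge {𝔟, 𝔠} of
-- an EV-system has 𝔠₁ ∈ 𝔟₂, this gives η[N(v)] ⊆ ε(𝔞)₂. The second hypothesis says that
-- ξ w ↦ η w is a well-defined injection of 𝔞₂ into η[N(v)], whence
-- #ε(𝔞)₂ ≤ #𝔞₂ ≤ #η[N(v)], and the inclusion is an equality.

open import Defs
open import Data.Product using (_×_; proj₁)
open import Relation.Binary.PropositionalEquality using (_≡_)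

open import Data.Product using (∃; _,_; proj₂; uncurry)
open import Data.Bool using (Bool; true; false; _∧_; not)
open import Data.Bool.Properties using (∧-conicalˡ; ∧-conicalʳ)
open import Data.Empty using (⊥-elim)
open import Function using (_∘_)
open import Data.Fin using (Fin; zero; suc; _≟_)
open import Data.Fin.Properties using (suc-injective; 0≢1+n)
open import Data.Fin.Subset using (Subset; _∈_; _⊆_; ∣_∣; _-_)
open import Data.Fin.Subset.Properties
  using (drop-∷-⊆; x∈p∧x≢y⇒x∈p-y; x∈p⇒∣p-x∣<∣p∣; p⊆q⇒∣p∣≤∣q∣)
open import Data.Nat as ℕ using (_≤_; z≤n; s≤s)
open import Data.Nat.Properties using (≤-trans; ≤-pred; <⇒≱)
open import Data.Vec using ([]; _∷_; lookup; tabulate; here; there)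
open import Data.Vec.Properties using (lookup⇒[]=; []=⇒lookup; lookup∘tabulate)
open import Relation.Nullary using (yes; no)
open import Relation.Nullary.Decidable using (⌊_⌋; isYes≗does; dec-true; dec-false)
open import Relation.Binary.PropositionalEquality using (_≢_; ≢-sym; refl; sym; trans; cong; cong₂)

⌊≟⌋-refl : ∀ {n} (x : Fin n) → ⌊ x ≟ x ⌋ ≡ true
⌊≟⌋-refl x = trans (isYes≗does (x ≟ x)) (dec-true (x ≟ x) refl)

⌊≟⌋-≢ : ∀ {n} {x y : Fin n} → x ≢ y → ⌊ x ≟ y ⌋ ≡ false
⌊≟⌋-≢ {x = x} {y} x≢y = trans (isYes≗does (x ≟ y)) (dec-false (x ≟ y) x≢y)

∈-tabulate⁺ : ∀ {n} (f : Fin n → Bool) {x} → f x ≡ true → x ∈ tabulate f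
∈-tabulate⁺ f {x} fx = lookup⇒[]= x _ (trans (lookup∘tabulate f x) fx)

∈-tabulate⁻ : ∀ {n} (f : Fin n → Bool) {x} → x ∈ tabulate f → f x ≡ true
∈-tabulate⁻ f {x} x∈ = trans (sym (lookup∘tabulate f x)) ([]=⇒lookup x∈)

anyᶠ⁺ : ∀ {n} (f : Fin n → Bool) (x : Fin n) → f x ≡ true → anyᶠ f ≡ true
anyᶠ⁺ f zero    fx rewrite fx = refl
anyᶠ⁺ f (suc x) fx with f zero
... | true  = refl
... | false = anyᶠ⁺ (λ y → f (suc y)) x fx

anyᶠ⁻ : ∀ {n} (f : Fin n → Bool) → anyᶠ f ≡ true → ∃ λ x → f x ≡ true
anyᶠ⁻ {ℕ.suc n} f any-f with f zero in f0
... | true  = zero , f0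
... | false with anyᶠ⁻ (λ x → f (suc x)) any-f
...   | x , fx = suc x , fx

∈-image⁺ : ∀ {m n} (f : Fin m → Fin n) (p : Subset m) {x} → x ∈ p → f x ∈ image f p
∈-image⁺ f p {x} x∈ =
  ∈-tabulate⁺ _ (anyᶠ⁺ _ x (cong₂ _∧_ ([]=⇒lookup x∈) (⌊≟⌋-refl (f x))))

∈-image⁻ : ∀ {m n} (f : Fin m → Fin n) (p : Subset m) {y} → y ∈ image f p →
           ∃ λ x → x ∈ p × f x ≡ y
∈-image⁻ f p {y} y∈ with anyᶠ⁻ _ (∈-tabulate⁻ _ y∈)
... | x , e with f x ≟ y
...   | yes fx≡y = x , lookup⇒[]= x p (∧-conicalˡ _ _ e) , fx≡y
...   | no _ with () ← ∧-conicalʳ (lookup p x) false e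

image⊆ : ∀ {m n} (f : Fin m → Fin n) (p : Subset m) {q : Subset n} →
  (∀ {x} → x ∈ p → f x ∈ q) → image f p ⊆ q
image⊆ f p f∈q y∈ with ∈-image⁻ f p y∈
... | x , x∈ , refl = f∈q x∈

∈-nbhd⁺ : (G : Graph) {v w : V G} → v ≢ w → adj G v w ≡ true → w ∈ nbhd G v
∈-nbhd⁺ G {v} {w} v≢w vw =
  ∈-tabulate⁺ (λ u → not ⌊ v ≟ u ⌋ ∧ adj G v u) (cong₂ _∧_ (cong not (⌊≟⌋-≢ v≢w)) vw)

∈-nbhd⁻ : (G : Graph) {v w : V G} → w ∈ nbhd G v → v ≢ w × adj G v w ≡ true
∈-nbhd⁻ G {v} {w} w∈ with v ≟ w | ∈-tabulate⁻ (λ u → not ⌊ v ≟ u ⌋ ∧ adj G v u) w∈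
... | no v≢w | e = v≢w , e

injection⇒∣p∣≤∣q∣ : ∀ {m n} (p : Subset m) (q : Subset n) (h : ∀ x → x ∈ p → Fin n) →
  (∀ x x∈p → h x x∈p ∈ q) →
  (∀ x y x∈p y∈p → h x x∈p ≡ h y y∈p → x ≡ y) →
  ∣ p ∣ ≤ ∣ q ∣
injection⇒∣p∣≤∣q∣ []          q h h∈q h-inj = z≤n
injection⇒∣p∣≤∣q∣ (false ∷ p) q h h∈q h-inj =
  injection⇒∣p∣≤∣q∣ p q (λ x x∈ → h (suc x) (there x∈)) (λ x x∈ → h∈q (suc x) (there x∈))
    (λ x y x∈ y∈ e → suc-injective (h-inj (suc x) (suc y) (there x∈) (there y∈) e))
injection⇒∣p∣≤∣q∣ (true ∷ p) q h h∈q h-inj =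
  ≤-trans (s≤s (injection⇒∣p∣≤∣q∣ p (q - h zero here) (λ x x∈ → h (suc x) (there x∈))
                  (λ x x∈ → x∈p∧x≢y⇒x∈p-y (h∈q (suc x) (there x∈))
                              (λ e → 0≢1+n (sym (h-inj (suc x) zero (there x∈) here e))))
                  (λ x y x∈ y∈ e → suc-injective (h-inj (suc x) (suc y) (there x∈) (there y∈) e))))
          (x∈p⇒∣p-x∣<∣p∣ (h∈q zero here))

⊆∧∣⊇∣⇒≡ : ∀ {n} (p q : Subset n) → p ⊆ q → ∣ q ∣ ≤ ∣ p ∣ → p ≡ q
⊆∧∣⊇∣⇒≡ []          []          p⊆q q≤p = refl
⊆∧∣⊇∣⇒≡ (true ∷ p)  (true ∷ q)  p⊆q q≤p = cong (true ∷_) (⊆∧∣⊇∣⇒≡ p q (drop-∷-⊆ p⊆q) (≤-pred q≤p))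
⊆∧∣⊇∣⇒≡ (false ∷ p) (false ∷ q) p⊆q q≤p = cong (false ∷_) (⊆∧∣⊇∣⇒≡ p q (drop-∷-⊆ p⊆q) q≤p)
⊆∧∣⊇∣⇒≡ (true ∷ p)  (false ∷ q) p⊆q q≤p with () ← p⊆q here
⊆∧∣⊇∣⇒≡ (false ∷ p) (true ∷ q)  p⊆q q≤p = ⊥-elim (<⇒≱ q≤p (p⊆q⇒∣p∣≤∣q∣ (drop-∷-⊆ p⊆q)))

factors⇒∣image∣≤∣image∣ : ∀ {m n l} (f : Fin m → Fin n) (g : Fin m → Fin l) (p : Subset m) →
  (∀ {x y} → x ∈ p → y ∈ p → g x ≡ g y → f x ≡ f y) →
  ∣ image f p ∣ ≤ ∣ image g p ∣
factors⇒∣image∣≤∣image∣ f g p factors =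
  injection⇒∣p∣≤∣q∣ (image f p) (image g p) h h∈ h-inj
  where
  h : ∀ y → y ∈ image f p → _
  h y y∈ = g (proj₁ (∈-image⁻ f p y∈))
  h∈ : ∀ y y∈ → h y y∈ ∈ image g p
  h∈ y y∈ = ∈-image⁺ g p (proj₁ (proj₂ (∈-image⁻ f p y∈)))
  h-inj : ∀ y y′ y∈ y′∈ → h y y∈ ≡ h y′ y′∈ → y ≡ y′
  h-inj y y′ y∈ y′∈ e with ∈-image⁻ f p y∈ | ∈-image⁻ f p y′∈
  ... | x , x∈ , refl | x′ , x′∈ , refl = factors x∈ x′∈ e

proper-EVEdge⇒comp₁∈comp₂ : ∀ {𝔘′} T {𝔞 𝔟} →
  EVEdge 𝔘′ T 𝔞 𝔟 → 𝔞 ≢ 𝔟 → comp₁ T 𝔟 ∈ comp₂ T 𝔞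
proper-EVEdge⇒comp₁∈comp₂ T (G , _ , ξ , v , w , vw , refl , refl) α≢α with v ≟ w
... | yes refl = ⊥-elim (α≢α refl)
... | no v≢w   = ∈-image⁺ (proj₁ ξ) (nbhd G v) (∈-nbhd⁺ G v≢w vw)

α-≢ : (G T : Graph) (ξ : StrictHom G T) {v w : V G} → w ∈ nbhd G v → α G T ξ v ≢ α G T ξ w
α-≢ G T (_ , _ , ξ-strict) {v} {w} w∈ = uncurry (ξ-strict v w) (∈-nbhd⁻ G w∈) ∘ cong (comp₁ T)

module _ {𝔘′ : Graph → Set} (G T : Graph) (G∈𝔘′ : 𝔘′ G) (ξ : StrictHom G T) where

  α-edge : ∀ {v w} → adj G v w ≡ true → EVEdge 𝔘′ T (α G T ξ v) (α G T ξ w)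
  α-edge {v} {w} vw = G , G∈𝔘′ , ξ , v , w , vw , refl , refl

  α-∈EVNbhd : ∀ {v w} → w ∈ nbhd G v → InEVNbhd 𝔘′ T (α G T ξ v) (α G T ξ w)
  α-∈EVNbhd w∈ = ≢-sym (α-≢ G T ξ w∈) , α-edge (proj₂ (∈-nbhd⁻ G w∈))

module _ (𝔘′ : Graph → Set) (R S : Graph) (ε : EVo R → EVo S)
         (ε-strict : IsStrictEVHom 𝔘′ R S ε) (G : Graph) (G∈𝔘′ : 𝔘′ G) (ξ : StrictHom G R) (v : V G) where

  image-η⊆comp₂-ε∘α : image (η R S G ε ξ) (nbhd G v) ⊆ comp₂ S (ε (α G R ξ v))
  image-η⊆comp₂-ε∘α = image⊆ (η R S G ε ξ) (nbhd G v) η∈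
    where
    η∈ : ∀ {w} → w ∈ nbhd G v → η R S G ε ξ w ∈ comp₂ S (ε (α G R ξ v))
    η∈ {w} w∈ = proper-EVEdge⇒comp₁∈comp₂ S (proj₁ ε-strict _ _ edge)
                                             (proj₂ ε-strict _ _ (α-≢ G R ξ w∈) edge)
      where
      edge : EVEdge 𝔘′ R (α G R ξ v) (α G R ξ w)
      edge = α-edge G R G∈𝔘′ ξ (proj₂ (∈-nbhd⁻ G w∈))

  α-η≡ε∘α : Hyp 𝔘′ R S ε (α G R ξ v) → αpair G S (η R S G ε ξ) v ≡ proj₁ (ε (α G R ξ v))
  α-η≡ε∘α (∣ε₂∣≤∣α₂∣ , ε₁-injective) =
    cong (comp₁ S (ε (α G R ξ v)) ,_)
      (⊆∧∣⊇∣⇒≡ _ _ image-η⊆comp₂-ε∘α (≤-trans ∣ε₂∣≤∣α₂∣ ∣α₂∣≤∣image-η∣))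
    where
    ∣α₂∣≤∣image-η∣ : ∣ comp₂ R (α G R ξ v) ∣ ≤ ∣ image (η R S G ε ξ) (nbhd G v) ∣
    ∣α₂∣≤∣image-η∣ = factors⇒∣image∣≤∣image∣ (proj₁ ξ) (η R S G ε ξ) (nbhd G v)
      λ x∈ y∈ → ε₁-injective _ _ (α-∈EVNbhd G R G∈𝔘′ ξ x∈) (α-∈EVNbhd G R G∈𝔘′ ξ y∈)

proposition7 : (𝔘′ : Graph → Set) (R S : Graph) (ε : EVo R → EVo S) →
    IsStrictEVHom 𝔘′ R S ε →
    ((𝔞 : EVo R) → Hyp 𝔘′ R S ε 𝔞 →
      (G : Graph) → 𝔘′ G → (ξ : StrictHom G R) → (v : V G) →
      α G R ξ v ≡ 𝔞 →
      αpair G S (η R S G ε ξ) v ≡ proj₁ (ε (α G R ξ v)))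
    ×
    (((𝔞 : EVo R) → Hyp 𝔘′ R S ε 𝔞) →
      (G : Graph) → 𝔘′ G → (ξ : StrictHom G R) → (v : V G) →
      αpair G S (η R S G ε ξ) v ≡ proj₁ (ε (α G R ξ v)))
proposition7 𝔘′ R S ε ε-strict =
  (λ { _ hyp G G∈𝔘′ ξ v refl → α-η≡ε∘α 𝔘′ R S ε ε-strict G G∈𝔘′ ξ v hyp }) ,
  (λ hyp G G∈𝔘′ ξ v → α-η≡ε∘α 𝔘′ R S ε ε-strict G G∈𝔘′ ξ v (hyp (α G R ξ v)))
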